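{- Let $G$ be a metric graph with vertex weights $\phi(v)\in(0,1]$, at least one vertex having weight $1$. Then the maximum edge length in $G$ is at most $\mathrm{OPT}_G$.
   Context: A metric graph is a complete undirected graph with positive edge lengths $l$ satisfying the triangle inequality. For an infinite walk $W$ in $G$, the latency $L(W,v)$ is the maximum length of the sub-walk between two consecutive occurrences of $v$ ($+\infty$ if $v$ does not occur infinitely often); the cost is $C(W)=\max_v\phi(v)L(W,v)$; $\mathrm{OPT}_G$ is the minimum cost over all infinite walks in $G$. -}

module Defs where

open import Level using (Level; _⊔_) renaming (suc to lsuc)
open import Algebra.Bundles using (CommutativeRing)
open import Relation.Binary.Core using (Rel)
open import Relation.Binary.Structures using (IsTotalOrder)
open import Relation.Nullary using (¬_)
open import Relation.Binary.PropositionalEquality using (_≡_; _≢_)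
open import Data.Product using (_×_; ∃; ∃-syntax; Σ-syntax)
open import Data.Nat as ℕ using (ℕ; zero; suc; _∸_)
open import Data.Fin using (Fin)

-- An ordered field (the reals ℝ are the intended instance; the stdlib has no reals).
record OrderedField (c ℓ₁ ℓ₂ : Level) : Set (lsuc (c ⊔ ℓ₁ ⊔ ℓ₂)) where
  field
    commutativeRing : CommutativeRing c ℓ₁
  open CommutativeRing commutativeRing public
  infix 4 _≤_ _<_
  field
    _≤_          : Rel Carrier ℓ₂
    isTotalOrder : IsTotalOrder _≈_ _≤_
    +-mono-≤     : ∀ {a b} d → a ≤ b → a + d ≤ b + d
    *-nonneg     : ∀ {a b} → 0# ≤ a → 0# ≤ b → 0# ≤ a * b
    0≉1          : ¬ (0# ≈ 1#)
    *-inverse    : ∀ a → ¬ (a ≈ 0#) → ∃ λ b → a * b ≈ 1#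

  _<_ : Rel Carrier (ℓ₁ ⊔ ℓ₂)
  a < b = Σ[ _ ∈ a ≤ b ] (¬ (a ≈ b))

module _ {c ℓ₁ ℓ₂} (F : OrderedField c ℓ₁ ℓ₂) where
  open OrderedField F

  -- A metric graph on vertex set Fin n: complete graph, edge length l u v for u ≢ v,
  -- positive, symmetric, satisfying the triangle inequality.
  record IsMetricGraph {n : ℕ} (l : Fin n → Fin n → Carrier) : Set (c ⊔ ℓ₁ ⊔ ℓ₂) where
    field
      positive  : ∀ u v → u ≢ v → 0# < l u v
      symmetric : ∀ u v → u ≢ v → l u v ≈ l v u
      triangle  : ∀ u v w → u ≢ v → v ≢ w → u ≢ w → l u w ≤ l u v + l v w

  IsInfiniteWalk : {n : ℕ} → (ℕ → Fin n) → Set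
  IsInfiniteWalk W = ∀ i → W i ≢ W (suc i)

  stepsLength : {n : ℕ} → (Fin n → Fin n → Carrier) → (ℕ → Fin n) → ℕ → ℕ → Carrier
  stepsLength l W i zero    = 0#
  stepsLength l W i (suc m) = l (W i) (W (suc i)) + stepsLength l W (suc i) m

  subwalkLength : {n : ℕ} → (Fin n → Fin n → Carrier) → (ℕ → Fin n) → ℕ → ℕ → Carrier
  subwalkLength l W i j = stepsLength l W i (j ∸ i)

  OccursInfinitelyOften : {n : ℕ} → (ℕ → Fin n) → Fin n → Set
  OccursInfinitelyOften W v = ∀ N → ∃[ k ] (N ℕ.≤ k × W k ≡ v)

  ConsecutiveOccurrences : {n : ℕ} → (ℕ → Fin n) → Fin n → ℕ → ℕ → Set
  ConsecutiveOccurrences W v i j =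
    i ℕ.< j × W i ≡ v × W j ≡ v × (∀ k → i ℕ.< k → k ℕ.< j → W k ≢ v)

  -- φ(v) · L(W,v) ≤ B : v occurs infinitely often and every sub-walk between two
  -- consecutive occurrences of v has φ(v)-weighted length ≤ B
  -- (B is an upper bound of the set whose supremum is φ(v)·L(W,v)).
  WeightedLatencyBoundedBy : {n : ℕ} → (Fin n → Fin n → Carrier) → (Fin n → Carrier)
                           → (ℕ → Fin n) → Fin n → Carrier → Set ℓ₂
  WeightedLatencyBoundedBy l φ W v B =
    OccursInfinitelyOften W v ×
    (∀ i j → ConsecutiveOccurrences W v i j → φ v * subwalkLength l W i j ≤ B)

  -- C(W) ≤ B, where C(W) = max_v φ(v) L(W,v)
  CostBoundedBy : {n : ℕ} → (Fin n → Fin n → Carrier) → (Fin n → Carrier)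
                → (ℕ → Fin n) → Carrier → Set ℓ₂
  CostBoundedBy l φ W B = ∀ v → WeightedLatencyBoundedBy l φ W v B

  -- x ≤ C(W) (in the extended sense): x is below every upper bound of C(W);
  -- vacuously true when C(W) = +∞.
  LeCost : {n : ℕ} → (Fin n → Fin n → Carrier) → (Fin n → Carrier)
         → (ℕ → Fin n) → Carrier → Set (c ⊔ ℓ₂)
  LeCost l φ W x = ∀ B → CostBoundedBy l φ W B → x ≤ B

  -- x ≤ OPT_G = inf_W C(W)  iff  x ≤ C(W) for every infinite walk W
  LeOPT : {n : ℕ} → (Fin n → Fin n → Carrier) → (Fin n → Carrier) → Carrier → Set (c ⊔ ℓ₂)
  LeOPT l φ x = ∀ (W : ℕ → _) → IsInfiniteWalk W → LeCost l φ W x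

-- Let φ(s) = 1. Every sub-walk between consecutive visits of s then has length at
-- most the cost of the walk. Any other vertex x is visited infinitely often, so
-- some such sub-walk passes through x, and by the triangle inequality it is at
-- least as long as the round trip s → x → s. Finally an edge u w is at most
-- l u s + l s w, hence at most the round trip from s to the farther of u and w.
module Submission where

open import Defs
open import Level using (Level)
open import Data.Nat as Nat using (ℕ; zero; suc; z≤n)
import Data.Nat.Properties as NatP
open import Data.Fin using (Fin; _≟_)
open import Data.Product using (_×_; _,_; proj₁; proj₂; ∃-syntax; ∃₂)
open import Data.Sum using (inj₁; inj₂)
open import Relation.Nullary using (¬_; yes; no; contradiction)
open import Relation.Unary using (Pred; Decidable)
open import Relation.Binary.Bundles using (Poset)
open import Relation.Binary.Definitions using (DecidableEquality)
open import Relation.Binary.Structures using (IsTotalOrder)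
open import Relation.Binary.PropositionalEquality
  using (_≡_; _≢_; refl; sym; trans; cong; cong₂; subst; ≢-sym)

module _ {p} {P : Pred ℕ p} (P? : Decidable P) where
  open Nat using (_+_; _≤_; _<_)
  open NatP using (≤-refl; <⇒≤; ≤⇒≯; m≤n⇒m≤1+n; m<1+n⇒m≤n; ≤∧≢⇒<; m≤n⇒m<n∨m≡n; +-suc)

  lastUpTo : ∀ {m} k → P m → m ≤ k →
             ∃[ i ] i ≤ k × P i × (∀ r → i < r → r ≤ k → ¬ P r)
  lastUpTo k Pm m≤k with P? k
  ... | yes Pk = k , ≤-refl , Pk , λ r k<r r≤k → contradiction k<r (≤⇒≯ r≤k)
  lastUpTo zero Pm z≤n | no ¬P0 = contradiction Pm ¬P0
  lastUpTo (suc k) Pm m≤1+k | no ¬P1+k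
    with lastUpTo k Pm (m<1+n⇒m≤n (≤∧≢⇒< m≤1+k λ { refl → ¬P1+k Pm }))
  ... | i , i≤k , Pi , noneAfter = i , m≤n⇒m≤1+n i≤k , Pi , noneAfter′
    where
    noneAfter′ : ∀ r → i < r → r ≤ suc k → ¬ P r
    noneAfter′ r i<r r≤1+k with m≤n⇒m<n∨m≡n r≤1+k
    ... | inj₁ r<1+k = noneAfter r i<r (m<1+n⇒m≤n r<1+k)
    ... | inj₂ refl  = ¬P1+k

  firstFrom : ∀ d k → P (d + k) →
              ∃[ j ] k ≤ j × P j × (∀ r → k ≤ r → r < j → ¬ P r)
  firstFrom d k Pd+k with P? k
  ... | yes Pk = k , ≤-refl , Pk , λ r k≤r r<k → contradiction r<k (≤⇒≯ k≤r)
  firstFrom zero    k Pk     | no ¬Pk = contradiction Pk ¬Pk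
  firstFrom (suc d) k Pd+1+k | no ¬Pk
    with firstFrom d (suc k) (subst P (sym (+-suc d k)) Pd+1+k)
  ... | j , k<j , Pj , noneBefore = j , <⇒≤ k<j , Pj , noneBefore′
    where
    noneBefore′ : ∀ r → k ≤ r → r < j → ¬ P r
    noneBefore′ r k≤r r<j with m≤n⇒m<n∨m≡n k≤r
    ... | inj₁ k<r  = noneBefore r k<r r<j
    ... | inj₂ refl = ¬Pk

∸-split : ∀ {i k j} → i Nat.≤ k → k Nat.≤ j → j Nat.∸ i ≡ (k Nat.∸ i) Nat.+ (j Nat.∸ k)
∸-split {i} {k} {j} i≤k k≤j = trans (cong (Nat._∸ i) (sym (NatP.m∸n+n≡m k≤j)))
  (trans (NatP.+-∸-assoc (j Nat.∸ k) i≤k) (NatP.+-comm (j Nat.∸ k) (k Nat.∸ i)))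

module _ {a} {A : Set a} (_≟ᴬ_ : DecidableEquality A) (W : ℕ → A) (v : A) where
  open Nat using (_∸_; _≤_; _<_; _≤?_)
  open NatP using (<⇒≤; ≰⇒>; ≤∧≢⇒<; m∸n+n≡m)

  occurrencesAround : ∀ {p k q} → W p ≡ v → p ≤ k → W k ≢ v → k ≤ q → W q ≡ v →
                      ∃₂ λ i j → i < k × k < j × W i ≡ v × W j ≡ v ×
                                 (∀ r → i < r → r < j → W r ≢ v)
  occurrencesAround {k = k} {q} Wp p≤k Wk≢v k≤q Wq
    with lastUpTo W≟v k Wp p≤k
       | firstFrom W≟v (q ∸ k) k (subst (λ r → W r ≡ v) (sym (m∸n+n≡m k≤q)) Wq)
    where
    W≟v : Decidable (λ r → W r ≡ v)
    W≟v r = W r ≟ᴬ v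
  ... | i , i≤k , Wi , noneAfterI | j , k≤j , Wj , noneBeforeJ =
    i , j , i<k , k<j , Wi , Wj , noneBetween
    where
    i<k : i < k
    i<k = ≤∧≢⇒< i≤k λ { refl → Wk≢v Wi }
    k<j : k < j
    k<j = ≤∧≢⇒< k≤j λ { refl → Wk≢v Wj }
    noneBetween : ∀ r → i < r → r < j → W r ≢ v
    noneBetween r i<r r<j with r ≤? k
    ... | yes r≤k = noneAfterI r i<r r≤k
    ... | no  r≰k = noneBeforeJ r (<⇒≤ (≰⇒> r≰k)) r<j

module _ {c ℓ₁ ℓ₂} (F : OrderedField c ℓ₁ ℓ₂) where
  open OrderedField F hiding (trans) renaming (refl to ≈-refl; sym to ≈-sym)
  open IsTotalOrder isTotalOrder using (total)
    renaming (refl to ≤-refl; trans to ≤-trans; reflexive to ≤-reflexive)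

  ≤-poset : Poset c ℓ₁ ℓ₂
  ≤-poset = record { isPartialOrder = IsTotalOrder.isPartialOrder isTotalOrder }

  open import Relation.Binary.Reasoning.PartialOrder ≤-poset

  +-monoʳ-≤ : ∀ {a b} d → a ≤ b → d + a ≤ d + b
  +-monoʳ-≤ {a} {b} d a≤b = begin
    d + a ≈⟨ +-comm d a ⟩
    a + d ≤⟨ +-mono-≤ d a≤b ⟩
    b + d ≈⟨ +-comm b d ⟩
    d + b ∎

  x≤x+y : ∀ {x y} → 0# ≤ y → x ≤ x + y
  x≤x+y {x} {y} 0≤y = begin
    x      ≈⟨ +-identityʳ x ⟨
    x + 0# ≤⟨ +-monoʳ-≤ x 0≤y ⟩
    x + y  ∎

  x≤y+x : ∀ {x y} → 0# ≤ y → x ≤ y + x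
  x≤y+x {x} {y} 0≤y = ≤-trans (x≤x+y 0≤y) (≤-reflexive (+-comm x y))

  module _ {n} {l : Fin n → Fin n → Carrier} (G : IsMetricGraph F l) where
    open IsMetricGraph G

    edge-nonneg : ∀ {u w} → u ≢ w → 0# ≤ l u w
    edge-nonneg u≢w = proj₁ (positive _ _ u≢w)

    edge≤roundTripBound : ∀ {s B} → (∀ x → x ≢ s → l s x + l x s ≤ B) →
                          ∀ {u w} → u ≢ w → l u w ≤ B
    edge≤roundTripBound {s} {B} roundTrip≤B {u} {w} u≢w with u ≟ s | w ≟ s
    ... | yes refl | yes refl = contradiction refl u≢w
    ... | yes refl | no w≢s   = ≤-trans (x≤x+y (edge-nonneg w≢s)) (roundTrip≤B w w≢s)
    ... | no u≢s   | yes refl = ≤-trans (x≤y+x (edge-nonneg (≢-sym u≢s))) (roundTrip≤B u u≢s)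
    ... | no u≢s   | no w≢s   with total (l s w) (l s u)
    ... | inj₁ sw≤su = begin
      l u w         ≤⟨ triangle u s w u≢s (≢-sym w≢s) u≢w ⟩
      l u s + l s w ≤⟨ +-monoʳ-≤ (l u s) sw≤su ⟩
      l u s + l s u ≈⟨ +-comm (l u s) (l s u) ⟩
      l s u + l u s ≤⟨ roundTrip≤B u u≢s ⟩
      B             ∎
    ... | inj₂ su≤sw = begin
      l u w         ≤⟨ triangle u s w u≢s (≢-sym w≢s) u≢w ⟩
      l u s + l s w ≈⟨ +-cong (symmetric u s u≢s) ≈-refl ⟩
      l s u + l s w ≤⟨ +-mono-≤ (l s w) su≤sw ⟩
      l s w + l s w ≈⟨ +-cong ≈-refl (symmetric s w (≢-sym w≢s)) ⟩
      l s w + l w s ≤⟨ roundTrip≤B w w≢s ⟩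
      B             ∎

    module _ {W : ℕ → Fin n} (walk : IsInfiniteWalk F W) where

      steps : ℕ → ℕ → Carrier
      steps = stepsLength F l W

      steps-nonneg : ∀ i m → 0# ≤ steps i m
      steps-nonneg i zero    = ≤-refl
      steps-nonneg i (suc m) = begin
        0#                                  ≈⟨ +-identityʳ 0# ⟨
        0# + 0#                             ≤⟨ +-mono-≤ 0# (edge-nonneg (walk i)) ⟩
        l (W i) (W (suc i)) + 0#            ≤⟨ +-monoʳ-≤ _ (steps-nonneg (suc i) m) ⟩
        l (W i) (W (suc i)) + steps (suc i) m ∎

      steps-+ : ∀ a {i k} b → a Nat.+ i ≡ k → steps i (a Nat.+ b) ≈ steps i a + steps k b
      steps-+ zero    b refl = ≈-sym (+-identityˡ (steps _ b))
      steps-+ (suc a) {i} b a+1+i≡k = begin-equality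
        l (W i) (W (suc i)) + steps (suc i) (a Nat.+ b)
          ≈⟨ +-cong ≈-refl (steps-+ a b (trans (NatP.+-suc a i) a+1+i≡k)) ⟩
        l (W i) (W (suc i)) + (steps (suc i) a + steps _ b)
          ≈⟨ +-assoc _ _ _ ⟨
        l (W i) (W (suc i)) + steps (suc i) a + steps _ b ∎

      chord≤steps : ∀ m {i j} → m Nat.+ i ≡ j → W i ≢ W j → l (W i) (W j) ≤ steps i m
      chord≤steps zero    refl Wi≢Wj = contradiction refl Wi≢Wj
      chord≤steps (suc m) {i} {j} m+1+i≡j Wi≢Wj with W (suc i) ≟ W j
      ... | yes W1+i≡Wj = begin
        l (W i) (W j)                          ≡⟨ cong (l (W i)) W1+i≡Wj ⟨
        l (W i) (W (suc i))                    ≤⟨ x≤x+y (steps-nonneg (suc i) m) ⟩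
        l (W i) (W (suc i)) + steps (suc i) m  ∎
      ... | no W1+i≢Wj = begin
        l (W i) (W j)                                   ≤⟨ triangle _ _ _ (walk i) W1+i≢Wj Wi≢Wj ⟩
        l (W i) (W (suc i)) + l (W (suc i)) (W j)
          ≤⟨ +-monoʳ-≤ _ (chord≤steps m (trans (NatP.+-suc m i) m+1+i≡j) W1+i≢Wj) ⟩
        l (W i) (W (suc i)) + steps (suc i) m           ∎

      subwalk : ℕ → ℕ → Carrier
      subwalk = subwalkLength F l W

      subwalk-split : ∀ {i k j} → i Nat.≤ k → k Nat.≤ j → subwalk i j ≈ subwalk i k + subwalk k j
      subwalk-split {i} {k} {j} i≤k k≤j = begin-equality
        steps i (j Nat.∸ i)                         ≡⟨ cong (steps i) (∸-split i≤k k≤j) ⟩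
        steps i ((k Nat.∸ i) Nat.+ (j Nat.∸ k))     ≈⟨ steps-+ (k Nat.∸ i) (j Nat.∸ k) (NatP.m∸n+n≡m i≤k) ⟩
        steps i (k Nat.∸ i) + steps k (j Nat.∸ k)   ∎

      chord≤subwalk : ∀ {i j} → i Nat.≤ j → W i ≢ W j → l (W i) (W j) ≤ subwalk i j
      chord≤subwalk {i} {j} i≤j = chord≤steps (j Nat.∸ i) (NatP.m∸n+n≡m i≤j)

      roundTrip≤subwalk : ∀ {i k j} → i Nat.≤ k → k Nat.≤ j → W i ≢ W k → W k ≢ W j →
                          l (W i) (W k) + l (W k) (W j) ≤ subwalk i j
      roundTrip≤subwalk {i} {k} {j} i≤k k≤j Wi≢Wk Wk≢Wj = begin
        l (W i) (W k) + l (W k) (W j) ≤⟨ +-mono-≤ _ (chord≤subwalk i≤k Wi≢Wk) ⟩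
        subwalk i k + l (W k) (W j)   ≤⟨ +-monoʳ-≤ _ (chord≤subwalk k≤j Wk≢Wj) ⟩
        subwalk i k + subwalk k j     ≈⟨ subwalk-split i≤k k≤j ⟨
        subwalk i j                   ∎

      roundTrip≤cost : ∀ {φ B s} → CostBoundedBy F l φ W B → φ s ≈ 1# →
                       ∀ x → x ≢ s → l s x + l x s ≤ B
      roundTrip≤cost {φ} {B} {s} cost≤B φs≈1 x x≢s
        with proj₁ (cost≤B s) 0
      ... | p , _ , Wp≡s with proj₁ (cost≤B x) p
      ... | k , p≤k , Wk≡x with proj₁ (cost≤B s) k
      ... | q , k≤q , Wq≡s
        with occurrencesAround _≟_ W s Wp≡s p≤k (λ Wk≡s → x≢s (trans (sym Wk≡x) Wk≡s)) k≤q Wq≡s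
      ... | i , j , i<k , k<j , Wi≡s , Wj≡s , noneBetween = begin
        l s x + l x s                 ≡⟨ cong₂ _+_ (cong₂ l Wi≡s Wk≡x) (cong₂ l Wk≡x Wj≡s) ⟨
        l (W i) (W k) + l (W k) (W j) ≤⟨ roundTrip≤subwalk (NatP.<⇒≤ i<k) (NatP.<⇒≤ k<j) Wi≢Wk Wk≢Wj ⟩
        subwalk i j                   ≈⟨ *-identityˡ _ ⟨
        1# * subwalk i j              ≈⟨ *-cong φs≈1 ≈-refl ⟨
        φ s * subwalk i j             ≤⟨ proj₂ (cost≤B s) i j (NatP.<-trans i<k k<j , Wi≡s , Wj≡s , noneBetween) ⟩
        B                             ∎
        where
        Wi≢Wk : W i ≢ W k
        Wi≢Wk Wi≡Wk = x≢s (trans (sym Wk≡x) (trans (sym Wi≡Wk) Wi≡s))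
        Wk≢Wj : W k ≢ W j
        Wk≢Wj Wk≡Wj = x≢s (trans (sym Wk≡x) (trans Wk≡Wj Wj≡s))

corollary3p4 : ∀ {c ℓ₁ ℓ₂ : Level} (F : OrderedField c ℓ₁ ℓ₂) (n : ℕ)
               (l : Fin n → Fin n → OrderedField.Carrier F)
               (φ : Fin n → OrderedField.Carrier F) →
               IsMetricGraph F l →
               (∀ v → OrderedField._<_ F (OrderedField.0# F) (φ v)
                      × OrderedField._≤_ F (φ v) (OrderedField.1# F)) →
               (∃[ v ] OrderedField._≈_ F (φ v) (OrderedField.1# F)) →
               ∀ u w → u ≢ w → LeOPT F l φ (l u w)
corollary3p4 F n l φ G _ (s , φs≈1) u w u≢w W walk B cost≤B =
  edge≤roundTripBound F G (roundTrip≤cost F G walk cost≤B φs≈1) u≢w
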